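{- Let $m \geq 1$ and $n \geq 1$ be integers and let $K_n$ be the complete graph on $n$ vertices. Then \[ \chi_m(K_n,\lambda) = \sum_{k=1}^{n} B_{n,k}(1_m)\,(\lambda)_k, \] where $(\lambda)_k = \lambda(\lambda-1)\cdots(\lambda-k+1)$ is the falling factorial.
   Context: For a graph $G$ and positive integer $\lambda$, the degree-chromatic polynomial $\chi_m(G,\lambda)$ is the number of colorings of the vertices of $G$ with $\lambda$ colors such that every vertex $v$ has at most $m-1$ neighbors having the same color as $v$ (it is a polynomial in $\lambda$). Bell polynomials: for integers $n,k \geq 0$, $B_{n,k}(x_1,x_2,\ldots,x_{n-k+1}) = \sum_{\alpha} \frac{n!}{\alpha_1!\cdots\alpha_{n-k+1}!}\prod_{i}\left(\frac{x_i}{i!}\right)^{\alpha_i}$, the sum over all sequences $\alpha$ of nonnegative integers with $\sum_i \alpha_i = k$ and $\sum_i i\,\alpha_i = n$. $1_m$ denotes the sequence $(x_1,x_2,\ldots)$ with $x_i = 1$ for $1\le i\le m$ and $x_i=0$ for $i>m$. -}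

module Defs where

open import Data.Nat as ℕ using (ℕ; zero; suc; _≤_; _∸_; _!; _≤?_)
open import Data.Nat.Properties using (_!≢0)
open import Data.Fin using (Fin; toℕ)
open import Data.Fin.Properties using () renaming (_≟_ to _≟ᶠ_)
open import Data.Vec using (Vec; []; _∷_; lookup)
open import Data.List using (List; []; _∷_; map; concatMap; filter; length; foldr; upTo; allFin)
open import Data.Integer using (+_)
open import Data.Rational as ℚ using (ℚ; 0ℚ; 1ℚ; _*_; _+_; _-_; _/_)
open import Relation.Nullary using (Dec; yes; no; ¬_)
open import Relation.Nullary.Decidable using (_×-dec_)
open import Relation.Unary using (Decidable)
open import Relation.Binary.PropositionalEquality using (_≡_)
open import Data.List.Relation.Unary.All using (all?)
open import Data.Product using (_×_)

allVecs : {A : Set} → List A → (L : ℕ) → List (Vec A L)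
allVecs xs zero    = [] ∷ []
allVecs xs (suc L) = concatMap (λ x → map (x ∷_) (allVecs xs L)) xs

sumℚ : List ℚ → ℚ
sumℚ = foldr _+_ 0ℚ

prodℚ : List ℚ → ℚ
prodℚ = foldr _*_ 1ℚ

_^ℚ_ : ℚ → ℕ → ℚ
q ^ℚ zero  = 1ℚ
q ^ℚ suc k = q * (q ^ℚ k)

ℕtoℚ : ℕ → ℚ
ℕtoℚ n = (+ n) / 1

record Graph (n : ℕ) : Set₁ where
  field
    Adj  : Fin n → Fin n → Set
    adj? : (u v : Fin n) → Dec (Adj u v)

K : (n : ℕ) → Graph n
K n = record { Adj = λ u v → ¬ (u ≡ v) ; adj? = λ u v → neg (u ≟ᶠ v) }
  where
  neg : {P : Set} → Dec P → Dec (¬ P)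
  neg (yes p) = no (λ f → f p)
  neg (no ¬p) = yes ¬p

sameColNbrs : {n λ' : ℕ} → Graph n → Vec (Fin λ') n → Fin n → ℕ
sameColNbrs {n} G c v =
  length (filter (λ u → Graph.adj? G v u ×-dec (lookup c u ≟ᶠ lookup c v)) (allFin n))

Good : {n λ' : ℕ} → ℕ → Graph n → Vec (Fin λ') n → Set
Good {n} m G c = Data.List.Relation.Unary.All.All (λ v → sameColNbrs G c v ≤ m ∸ 1) (allFin n)

good? : {n λ' : ℕ} (m : ℕ) (G : Graph n) → Decidable (Good {n} {λ'} m G)
good? {n} m G c = all? (λ v → sameColNbrs G c v ≤? m ∸ 1) (allFin n)

-- degree-chromatic polynomial evaluated at a positive integer λ:
-- number of colourings Fin n → Fin λ with every vertex having at most m-1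
-- neighbours of its own colour
degChrom : {n : ℕ} → ℕ → Graph n → ℕ → ℕ
degChrom {n} m G λ' = length (filter (good? m G) (allVecs (allFin λ') n))

-- Bell polynomials B_{n,k}(x_1, …, x_{n-k+1}) evaluated at a sequence x : ℕ → ℚ
-- (index i ≥ 1 uses x i).  The sum ranges over α = (α_1,…,α_{n-k+1}) of
-- nonnegative integers with Σ α_i = k and Σ i α_i = n; every such α has all
-- α_i ≤ n, so enumerating vectors with entries in {0,…,n} is exhaustive.

indexed : {L : ℕ} → Vec ℕ L → List (ℕ × ℕ)
indexed {L} α = map (λ j → Data.Product._,_ (suc (toℕ j)) (lookup α j)) (allFin L)

sumNat : List ℕ → ℕ
sumNat = foldr ℕ._+_ 0

Admissible : (n k : ℕ) {L : ℕ} → Vec ℕ L → Set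
Admissible n k α =
  (sumNat (map Data.Product.proj₂ (indexed α)) ≡ k) ×
  (sumNat (map (λ p → Data.Product.proj₁ p ℕ.* Data.Product.proj₂ p) (indexed α)) ≡ n)

admissible? : (n k : ℕ) {L : ℕ} → Decidable (Admissible n k {L})
admissible? n k α = (_ ℕ.≟ k) ×-dec (_ ℕ.≟ n)

bellTerm : (n : ℕ) → (ℕ → ℚ) → {L : ℕ} → Vec ℕ L → ℚ
bellTerm n x α =
  ((+ (n !)) / 1) *
  prodℚ (map (λ p → (1ℚ ÷! Data.Product.proj₂ p) *
                    ((x (Data.Product.proj₁ p) * (1ℚ ÷! Data.Product.proj₁ p)) ^ℚ Data.Product.proj₂ p))
             (indexed α))
  where
  _÷!_ : ℚ → ℕ → ℚ
  q ÷! a = q * ((+ 1) / (a !)) where instance _ = a !≢0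

bell : (n k : ℕ) → (ℕ → ℚ) → ℚ
bell n k x =
  sumℚ (map (bellTerm n x)
            (filter (admissible? n k) (allVecs (upTo (suc n)) (suc (n ∸ k)))))

one[_] : ℕ → ℕ → ℚ
one[ m ] i with i ≤? m
... | yes _ = 1ℚ
... | no  _ = 0ℚ

falling : ℕ → ℕ → ℚ
falling λ' zero    = 1ℚ
falling λ' (suc k) = falling λ' k * (ℕtoℚ λ' - ℕtoℚ k)

sumFrom1 : ℕ → (ℕ → ℚ) → ℚ
sumFrom1 n f = sumℚ (map (λ i → f (suc i)) (upTo n))

{-# OPTIONS --safe #-}
module Submission where

-- Both sides are n! times the coefficient of tⁿ in E(t)^λ, where E(t) = Σ_{i ≤ m} tⁱ / i!.
--
-- In K_n a vertex has at most m - 1 neighbours of its own colour exactly when every colour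
-- class has at most m vertices.  Choosing the class of one colour and colouring the remaining
-- vertices with the other colours gives the exponential formula: there are n! [tⁿ] E^λ such
-- colourings.
--
-- By the multinomial theorem B_{n,k}(x) = (n!/k!) [tⁿ] X^k with X = Σ_{i ≥ 1} x_i tⁱ / i!, and
-- (λ)_k = C(λ, k) k!, so Σ_k B_{n,k}(x) (λ)_k = n! [tⁿ] Σ_k C(λ, k) X^k = n! [tⁿ] (1 + X)^λ by the
-- binomial theorem; for x = 1_m, 1 + X = E.

open import Defs
open import Algebra.Bundles using (CommutativeSemiring; CommutativeRing)
import Algebra.Construct.Pointwise
import Algebra.Properties.CommutativeMonoid.Sum
import Algebra.Properties.CommutativeSemigroup as CommSemigroupProperties
import Algebra.Structures.Biased as Biased
open import Data.Bool using (if_then_else_)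
open import Data.Fin as Fin using (Fin; toℕ)
open import Data.Fin.Properties using (toℕ<n; punchInᵢ≢i; any?; all?) renaming (_≟_ to _≟ᶠ_)
import Data.Integer as ℤ
import Data.Integer.Properties as ℤₚ
open import Data.List using (List; []; _∷_; map; filter; length; upTo; applyUpTo; _++_; concatMap; tabulate; allFin)
import Data.List.Properties as Listₚ
open import Data.List.Relation.Unary.All.Properties using (tabulate⁺; tabulate⁻)
open import Data.Nat as ℕ using (ℕ; zero; suc; _≤_; _<_; _∸_; _!; _≤?_; z≤n; s≤s; NonZero)
open import Data.Nat.Combinatorics
  using (_C_; _P_; nCk+nC[k+1]≡[n+1]C[k+1]; nCk≡nPk/k!; k![n∸k]!∣n!; k>n⇒nCk≡0; nCk≡n!/k![n-k]!)
open import Data.Nat.Combinatorics.Base using (_P′_)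
open import Data.Nat.Combinatorics.Specification using (k!∣nP′k; nP′k≡n!/[n∸k]!; nPk≡n!/[n∸k]!)
open import Data.Nat.Coprimality as Coprime using (1-coprimeTo)
open import Data.Nat.DivMod using (m/n*n≡m)
import Data.Nat.Properties as ℕₚ
open import Data.Nat.Properties using (_!≢0; _!*_!≢0)
open import Data.Product using (_×_; _,_; proj₁; proj₂)
open import Data.Rational as ℚ using (ℚ; mkℚ; 0ℚ; 1ℚ; _+_; _*_; _-_; _/_)
import Data.Rational.Properties as ℚₚ
open import Data.Rational.Solver using (module +-*-Solver)
open import Data.Sum using (inj₁; inj₂)
open import Data.Vec using (Vec; []; _∷_; lookup; toList)
open import Data.Vec.Functional using (removeAt)
open import Function using (_∘_; _⇔_; mk⇔)
open import Level using (0ℓ)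
open import Relation.Binary.PropositionalEquality
open import Relation.Nullary using (Dec; yes; no; ¬_; does)
open import Relation.Nullary.Decidable using (_×-dec_; does-⇔; dec-true; dec-false)

open import Algebra.Properties.Semiring.Sum (CommutativeRing.semiring ℚₚ.+-*-commutativeRing)
  using (sum; sum-cong-≗; sum-replicate-zero; ∑-distrib-+; ∑-comm; *-distribˡ-sum)
module ℕΣ = Algebra.Properties.CommutativeMonoid.Sum ℕₚ.+-0-commutativeMonoid
module ℚ-* = CommSemigroupProperties (CommutativeRing.*-commutativeSemigroup ℚₚ.+-*-commutativeRing)
module ℕ-* = CommSemigroupProperties ℕₚ.*-commutativeSemigroup
open +-*-Solver using (solve; _:=_; _:+_; _:*_; _:-_; con)
open ≡-Reasoning

-- Natural numbers inside ℚ

ℕtoℚ≡mkℚ : ∀ n → ℕtoℚ n ≡ mkℚ (ℤ.+ n) 0 (Coprime.sym (1-coprimeTo n))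
ℕtoℚ≡mkℚ n = ℚₚ.normalize-coprime (Coprime.sym (1-coprimeTo n))

ℕtoℚ-+ : ∀ a b → ℕtoℚ (a ℕ.+ b) ≡ ℕtoℚ a + ℕtoℚ b
ℕtoℚ-+ a b = begin
  ℕtoℚ (a ℕ.+ b)
    ≡⟨ cong (_/ 1) (cong₂ ℤ._+_ (ℤₚ.*-identityʳ (ℤ.+ a)) (ℤₚ.*-identityʳ (ℤ.+ b))) ⟨
  (ℤ.+ a ℤ.* ℤ.+ 1 ℤ.+ ℤ.+ b ℤ.* ℤ.+ 1) / 1
    ≡⟨ cong₂ _+_ (ℕtoℚ≡mkℚ a) (ℕtoℚ≡mkℚ b) ⟨
  ℕtoℚ a + ℕtoℚ b
    ∎

ℕtoℚ-* : ∀ a b → ℕtoℚ (a ℕ.* b) ≡ ℕtoℚ a * ℕtoℚ b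
ℕtoℚ-* a b = begin
  ℕtoℚ (a ℕ.* b)        ≡⟨ cong (_/ 1) (ℤₚ.pos-* a b) ⟩
  (ℤ.+ a ℤ.* ℤ.+ b) / 1 ≡⟨ cong₂ _*_ (ℕtoℚ≡mkℚ a) (ℕtoℚ≡mkℚ b) ⟨
  ℕtoℚ a * ℕtoℚ b       ∎

ℕtoℚ-∸ : ∀ {a b} → b ≤ a → ℕtoℚ (a ∸ b) ≡ ℕtoℚ a - ℕtoℚ b
ℕtoℚ-∸ {a} {b} b≤a = begin
  ℕtoℚ (a ∸ b)                   ≡⟨ solve 2 (λ u v → u := u :+ v :- v) refl (ℕtoℚ (a ∸ b)) (ℕtoℚ b) ⟩
  ℕtoℚ (a ∸ b) + ℕtoℚ b - ℕtoℚ b ≡⟨ cong (_- ℕtoℚ b) (ℕtoℚ-+ (a ∸ b) b) ⟨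
  ℕtoℚ (a ∸ b ℕ.+ b) - ℕtoℚ b    ≡⟨ cong (λ c → ℕtoℚ c - ℕtoℚ b) (ℕₚ.m∸n+n≡m b≤a) ⟩
  ℕtoℚ a - ℕtoℚ b                ∎

1/n*n≡1 : ∀ n .{{_ : NonZero n}} → ((ℤ.+ 1) / n) * ℕtoℚ n ≡ 1ℚ
1/n*n≡1 (suc n) = begin
  ((ℤ.+ 1) / suc n) * ℕtoℚ (suc n)
    ≡⟨ cong₂ _*_ (ℚₚ.normalize-coprime (1-coprimeTo (suc n))) (ℕtoℚ≡mkℚ (suc n)) ⟩
  ℚ.1/ n+1 * n+1
    ≡⟨ ℚₚ.*-inverseˡ n+1 ⟩
  1ℚ
    ∎
  where n+1 = mkℚ (ℤ.+ suc n) 0 (Coprime.sym (1-coprimeTo (suc n)))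

inv! : ℕ → ℚ
inv! a = ((ℤ.+ 1) / a !) {{a !≢0}}

k!*nCk*[n∸k]!≡n! : ∀ {n k} → k ≤ n → k ! ℕ.* ((n C k) ℕ.* (n ∸ k) !) ≡ n !
k!*nCk*[n∸k]!≡n! {n} {k} k≤n = begin
  k ! ℕ.* ((n C k) ℕ.* (n ∸ k) !)                       ≡⟨ ℕ-*.x∙yz≈y∙xz (k !) (n C k) ((n ∸ k) !) ⟩
  (n C k) ℕ.* (k ! ℕ.* (n ∸ k) !)                       ≡⟨ cong (ℕ._* (k ! ℕ.* (n ∸ k) !)) (nCk≡n!/k![n-k]! k≤n) ⟩
  (n ! ℕ./ (k ! ℕ.* (n ∸ k) !)) ℕ.* (k ! ℕ.* (n ∸ k) !) ≡⟨ m/n*n≡m (k![n∸k]!∣n! k≤n) ⟩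
  n !                                                   ∎
  where instance _ = k !* (n ∸ k) !≢0

n!*inv!k≡nCk*[n∸k]! : ∀ {n k} → k ≤ n → ℕtoℚ (n !) * inv! k ≡ ℕtoℚ ((n C k) ℕ.* (n ∸ k) !)
n!*inv!k≡nCk*[n∸k]! {n} {k} k≤n = begin
  ℕtoℚ (n !) * inv! k            ≡⟨ cong (λ m → ℕtoℚ m * inv! k) (k!*nCk*[n∸k]!≡n! k≤n) ⟨
  ℕtoℚ (k ! ℕ.* c) * inv! k      ≡⟨ cong (_* inv! k) (ℕtoℚ-* (k !) c) ⟩
  ℕtoℚ (k !) * ℕtoℚ c * inv! k   ≡⟨ ℚ-*.xy∙z≈y∙zx (ℕtoℚ (k !)) (ℕtoℚ c) (inv! k) ⟩
  ℕtoℚ c * (inv! k * ℕtoℚ (k !)) ≡⟨ cong (ℕtoℚ c *_) (1/n*n≡1 (k !) {{k !≢0}}) ⟩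
  ℕtoℚ c * 1ℚ                    ≡⟨ ℚₚ.*-identityʳ (ℕtoℚ c) ⟩
  ℕtoℚ c                         ∎
  where c = (n C k) ℕ.* (n ∸ k) !

falling≡P′ : ∀ {l k} → k ≤ l → falling l k ≡ ℕtoℚ (l P′ k)
falling≡P′ {l} {zero}  _   = refl
falling≡P′ {l} {suc k} k<l = begin
  falling l k * (ℕtoℚ l - ℕtoℚ k) ≡⟨ cong₂ _*_ (falling≡P′ (ℕₚ.<⇒≤ k<l)) (sym (ℕtoℚ-∸ (ℕₚ.<⇒≤ k<l))) ⟩
  ℕtoℚ (l P′ k) * ℕtoℚ (l ∸ k)    ≡⟨ ℕtoℚ-* (l P′ k) (l ∸ k) ⟨
  ℕtoℚ ((l P′ k) ℕ.* (l ∸ k))     ≡⟨ cong ℕtoℚ (ℕₚ.*-comm (l P′ k) (l ∸ k)) ⟩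
  ℕtoℚ (l P′ suc k)               ∎

falling-vanishes : ∀ {l k} → l < k → falling l k ≡ 0ℚ
falling-vanishes {l} {suc k} (s≤s l≤k) with ℕₚ.m≤n⇒m<n∨m≡n l≤k
... | inj₁ l<k  = trans (cong (_* (ℕtoℚ l - ℕtoℚ k)) (falling-vanishes l<k)) (ℚₚ.*-zeroˡ (ℕtoℚ l - ℕtoℚ k))
... | inj₂ refl = trans (cong (falling l l *_) (ℚₚ.+-inverseʳ (ℕtoℚ l))) (ℚₚ.*-zeroʳ (falling l l))

nP′k≡nCk*k! : ∀ {n k} → k ≤ n → n P′ k ≡ (n C k) ℕ.* k !
nP′k≡nCk*k! {n} {k} k≤n = begin
  n P′ k                     ≡⟨ m/n*n≡m (k!∣nP′k k≤n) ⟨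
  ((n P′ k) ℕ./ k !) ℕ.* k ! ≡⟨ cong (λ p → (p ℕ./ k !) ℕ.* k !) P′≡P ⟩
  ((n P k) ℕ./ k !) ℕ.* k !  ≡⟨ cong (ℕ._* k !) (nCk≡nPk/k! k≤n) ⟨
  (n C k) ℕ.* k !            ∎
  where
  instance _ = k !≢0
  P′≡P = trans (nP′k≡n!/[n∸k]! k≤n) (sym (nPk≡n!/[n∸k]! k≤n))

falling≡nCk*k! : ∀ l k → falling l k ≡ ℕtoℚ ((l C k) ℕ.* k !)
falling≡nCk*k! l k with k ≤? l
... | yes k≤l = trans (falling≡P′ k≤l) (cong ℕtoℚ (nP′k≡nCk*k! k≤l))
... | no  k≰l = trans (falling-vanishes (ℕₚ.≰⇒> k≰l))
                      (cong (λ c → ℕtoℚ (c ℕ.* k !)) (sym (k>n⇒nCk≡0 (ℕₚ.≰⇒> k≰l))))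

-- Iverson brackets and finite sums

⟦_⟧ : {P : Set} → Dec P → ℚ
⟦ P? ⟧ = if does P? then 1ℚ else 0ℚ

⟦⟧-⇔ : {P Q : Set} → P ⇔ Q → (P? : Dec P) (Q? : Dec Q) → ⟦ P? ⟧ ≡ ⟦ Q? ⟧
⟦⟧-⇔ P⇔Q P? Q? = cong (λ b → if b then 1ℚ else 0ℚ) (does-⇔ P⇔Q P? Q?)

⟦⟧-yes : {P : Set} (P? : Dec P) → P → ⟦ P? ⟧ ≡ 1ℚ
⟦⟧-yes P? p = cong (λ b → if b then 1ℚ else 0ℚ) (dec-true P? p)

⟦⟧-no : {P : Set} (P? : Dec P) → ¬ P → ⟦ P? ⟧ ≡ 0ℚ
⟦⟧-no P? ¬p = cong (λ b → if b then 1ℚ else 0ℚ) (dec-false P? ¬p)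

⟦⟧-× : {P Q : Set} (P? : Dec P) (Q? : Dec Q) → ⟦ P? ×-dec Q? ⟧ ≡ ⟦ P? ⟧ * ⟦ Q? ⟧
⟦⟧-× (yes _) Q? = sym (ℚₚ.*-identityˡ ⟦ Q? ⟧)
⟦⟧-× (no _)  Q? = sym (ℚₚ.*-zeroˡ ⟦ Q? ⟧)

⟦_⟧ℕ : {P : Set} → Dec P → ℕ
⟦ P? ⟧ℕ = if does P? then 1 else 0

⟦⟧ℕ-⇔ : {P Q : Set} → P ⇔ Q → (P? : Dec P) (Q? : Dec Q) → ⟦ P? ⟧ℕ ≡ ⟦ Q? ⟧ℕ
⟦⟧ℕ-⇔ P⇔Q P? Q? = cong (λ b → if b then 1 else 0) (does-⇔ P⇔Q P? Q?)

⟦⟧ℕ-yes : {P : Set} (P? : Dec P) → P → ⟦ P? ⟧ℕ ≡ 1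
⟦⟧ℕ-yes P? p = cong (λ b → if b then 1 else 0) (dec-true P? p)

⟦⟧ℕ-no : {P : Set} (P? : Dec P) → ¬ P → ⟦ P? ⟧ℕ ≡ 0
⟦⟧ℕ-no P? ¬p = cong (λ b → if b then 1 else 0) (dec-false P? ¬p)

sumℚ-++ : ∀ xs ys → sumℚ (xs ++ ys) ≡ sumℚ xs + sumℚ ys
sumℚ-++ []       ys = sym (ℚₚ.+-identityˡ (sumℚ ys))
sumℚ-++ (x ∷ xs) ys = trans (cong (x +_) (sumℚ-++ xs ys)) (sym (ℚₚ.+-assoc x (sumℚ xs) (sumℚ ys)))

sumℚ-concatMap : ∀ {A B : Set} (F : B → ℚ) (g : A → List B) xs →
                 sumℚ (map F (concatMap g xs)) ≡ sumℚ (map (λ a → sumℚ (map F (g a))) xs)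
sumℚ-concatMap F g []       = refl
sumℚ-concatMap F g (a ∷ xs) = begin
  sumℚ (map F (g a ++ concatMap g xs))               ≡⟨ cong sumℚ (Listₚ.map-++ F (g a) (concatMap g xs)) ⟩
  sumℚ (map F (g a) ++ map F (concatMap g xs))       ≡⟨ sumℚ-++ (map F (g a)) (map F (concatMap g xs)) ⟩
  sumℚ (map F (g a)) + sumℚ (map F (concatMap g xs)) ≡⟨ cong (sumℚ (map F (g a)) +_) (sumℚ-concatMap F g xs) ⟩
  sumℚ (map (λ a → sumℚ (map F (g a))) (a ∷ xs))     ∎

sumℚ-*ˡ : ∀ {A : Set} c (F : A → ℚ) xs → c * sumℚ (map F xs) ≡ sumℚ (map (λ a → c * F a) xs)
sumℚ-*ˡ c F []       = ℚₚ.*-zeroʳ c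
sumℚ-*ˡ c F (a ∷ xs) = trans (ℚₚ.*-distribˡ-+ c (F a) _) (cong (c * F a +_) (sumℚ-*ˡ c F xs))

sumℚ-filter : ∀ {A : Set} {P : A → Set} (P? : ∀ a → Dec (P a)) (F : A → ℚ) xs →
              sumℚ (map F (filter P? xs)) ≡ sumℚ (map (λ a → ⟦ P? a ⟧ * F a) xs)
sumℚ-filter P? F []       = refl
sumℚ-filter P? F (a ∷ xs) with P? a
... | yes _ = cong₂ _+_ (sym (ℚₚ.*-identityˡ (F a))) (sumℚ-filter P? F xs)
... | no  _ = trans (sumℚ-filter P? F xs) (sym (trans (cong (_+ _) (ℚₚ.*-zeroˡ (F a))) (ℚₚ.+-identityˡ _)))

length-filter≡sumℚ : ∀ {A : Set} {P : A → Set} (P? : ∀ a → Dec (P a)) xs →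
                     ℕtoℚ (length (filter P? xs)) ≡ sumℚ (map (λ a → ⟦ P? a ⟧) xs)
length-filter≡sumℚ P? []       = refl
length-filter≡sumℚ P? (a ∷ xs) with P? a
... | yes _ = trans (ℕtoℚ-+ 1 (length (filter P? xs))) (cong (1ℚ +_) (length-filter≡sumℚ P? xs))
... | no  _ = trans (length-filter≡sumℚ P? xs) (sym (ℚₚ.+-identityˡ _))

length-filter-tabulate : ∀ {A : Set} {P : A → Set} (P? : ∀ a → Dec (P a)) {n} (f : Fin n → A) →
                         length (filter P? (tabulate f)) ≡ ℕΣ.sum (λ i → ⟦ P? (f i) ⟧ℕ)
length-filter-tabulate P? {zero}  f = refl
length-filter-tabulate P? {suc n} f with P? (f Fin.zero)
... | yes _ = cong suc (length-filter-tabulate P? (f ∘ Fin.suc))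
... | no  _ = length-filter-tabulate P? (f ∘ Fin.suc)

sumℚ-tabulate : ∀ {A : Set} {n} (F : A → ℚ) (g : Fin n → A) → sumℚ (map F (tabulate g)) ≡ sum (F ∘ g)
sumℚ-tabulate {n = zero}  F g = refl
sumℚ-tabulate {n = suc n} F g = cong (F (g Fin.zero) +_) (sumℚ-tabulate F (g ∘ Fin.suc))

Σ : ℕ → (ℕ → ℚ) → ℚ
Σ n F = sum {n} (F ∘ toℕ)

sumℚ-applyUpTo : ∀ (F : ℕ → ℚ) (g : ℕ → ℕ) n → sumℚ (map F (applyUpTo g n)) ≡ Σ n (F ∘ g)
sumℚ-applyUpTo F g zero    = refl
sumℚ-applyUpTo F g (suc n) = cong (F (g 0) +_) (sumℚ-applyUpTo F (g ∘ suc) n)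

Σ-cong : ∀ n {F G : ℕ → ℚ} → (∀ i → i < n → F i ≡ G i) → Σ n F ≡ Σ n G
Σ-cong n F≡G = sum-cong-≗ (λ i → F≡G (toℕ i) (toℕ<n i))

Σ-zero : ∀ n {F : ℕ → ℚ} → (∀ i → i < n → F i ≡ 0ℚ) → Σ n F ≡ 0ℚ
Σ-zero n F≡0 = trans (Σ-cong n F≡0) (sum-replicate-zero n)

Σ-+ : ∀ n (F G : ℕ → ℚ) → Σ n (λ i → F i + G i) ≡ Σ n F + Σ n G
Σ-+ n F G = ∑-distrib-+ {n} (F ∘ toℕ) (G ∘ toℕ)

Σ-*ˡ : ∀ n c (F : ℕ → ℚ) → c * Σ n F ≡ Σ n (λ i → c * F i)
Σ-*ˡ n c F = *-distribˡ-sum {n} c (F ∘ toℕ)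

Σ-last : ∀ n (F : ℕ → ℚ) → Σ (suc n) F ≡ Σ n F + F n
Σ-last zero    F = trans (ℚₚ.+-identityʳ (F 0)) (sym (ℚₚ.+-identityˡ (F 0)))
Σ-last (suc n) F = trans (cong (F 0 +_) (Σ-last n (F ∘ suc))) (sym (ℚₚ.+-assoc (F 0) _ _))

Σ-extend : ∀ {K N} (F : ℕ → ℚ) → K ≤ N → (∀ i → K ≤ i → i < N → F i ≡ 0ℚ) → Σ N F ≡ Σ K F
Σ-extend {zero}  {N}     F _         F≡0 = Σ-zero N (λ i → F≡0 i z≤n)
Σ-extend {suc K} {suc N} F (s≤s K≤N) F≡0 =
  cong (F 0 +_) (Σ-extend (F ∘ suc) K≤N (λ i K≤i i<N → F≡0 (suc i) (s≤s K≤i) (s≤s i<N)))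

Σ-restrict : ∀ {k N} (F : ℕ → ℚ) → k ≤ N → Σ (suc N) (λ a → ⟦ a ≤? k ⟧ * F a) ≡ Σ (suc k) F
Σ-restrict {k} {N} F k≤N = begin
  Σ (suc N) (λ a → ⟦ a ≤? k ⟧ * F a)
    ≡⟨ Σ-extend _ (s≤s k≤N) (λ a k<a _ → trans (cong (_* F a) (⟦⟧-no (a ≤? k) (ℕₚ.<⇒≱ k<a))) (ℚₚ.*-zeroˡ (F a))) ⟩
  Σ (suc k) (λ a → ⟦ a ≤? k ⟧ * F a)
    ≡⟨ Σ-cong (suc k) (λ a a≤k → trans (cong (_* F a) (⟦⟧-yes (a ≤? k) (ℕₚ.≤-pred a≤k))) (ℚₚ.*-identityˡ (F a))) ⟩
  Σ (suc k) F
    ∎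

Σ-reverse : ∀ n (F : ℕ → ℚ) → Σ (suc n) F ≡ Σ (suc n) (λ i → F (n ∸ i))
Σ-reverse zero    F = refl
Σ-reverse (suc n) F = begin
  F 0 + Σ (suc n) (F ∘ suc)
    ≡⟨ cong (F 0 +_) (Σ-reverse n (F ∘ suc)) ⟩
  F 0 + Σ (suc n) (λ i → F (suc (n ∸ i)))
    ≡⟨ ℚₚ.+-comm (F 0) (Σ (suc n) (λ i → F (suc (n ∸ i)))) ⟩
  Σ (suc n) (λ i → F (suc (n ∸ i))) + F 0
    ≡⟨ cong₂ _+_ (Σ-cong (suc n) λ i i≤n → cong F (sym (ℕₚ.+-∸-assoc 1 (ℕₚ.≤-pred i≤n))))
                 (cong F (sym (ℕₚ.n∸n≡0 n))) ⟩
  Σ (suc n) (λ i → F (suc n ∸ i)) + F (suc n ∸ suc n)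
    ≡⟨ Σ-last (suc n) (λ i → F (suc n ∸ i)) ⟨
  Σ (suc (suc n)) (λ i → F (suc n ∸ i))
    ∎

Σ-δ : ∀ n s (F : ℕ → ℚ) → Σ (suc n) (λ i → ⟦ s ℕ.≟ i ⟧ * F i) ≡ ⟦ s ≤? n ⟧ * F s
Σ-δ n       zero    F = trans (cong (1ℚ * F 0 +_) (Σ-zero n (λ i _ → ℚₚ.*-zeroˡ (F (suc i))))) (ℚₚ.+-identityʳ _)
Σ-δ zero    (suc s) F = trans (ℚₚ.+-identityʳ _) (trans (ℚₚ.*-zeroˡ (F 0)) (sym (ℚₚ.*-zeroˡ (F (suc s)))))
Σ-δ (suc n) (suc s) F = begin
  0ℚ * F 0 + Σ (suc n) G ≡⟨ cong (_+ Σ (suc n) G) (ℚₚ.*-zeroˡ (F 0)) ⟩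
  0ℚ + Σ (suc n) G       ≡⟨ ℚₚ.+-identityˡ _ ⟩
  Σ (suc n) G            ≡⟨ Σ-δ n s (F ∘ suc) ⟩
  ⟦ s ≤? n ⟧ * F (suc s) ≡⟨ cong (_* F (suc s)) (⟦⟧-⇔ (mk⇔ s≤s ℕₚ.≤-pred) (s ≤? n) (suc s ≤? suc n)) ⟩
  ⟦ suc s ≤? suc n ⟧ * F (suc s) ∎
  where
  G : ℕ → ℚ
  G i = ⟦ s ℕ.≟ i ⟧ * F (suc i)

-- Formal power series over ℚ

Series : Set
Series = ℕ → ℚ

infix  4 _≋_
infixl 6 _⊕_
infixl 7 _⊛_

_≋_ : Series → Series → Set
f ≋ g = ∀ n → f n ≡ g n

_⊕_ : Series → Series → Series
(f ⊕ g) n = f n + g n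

_⊛_ : Series → Series → Series
(f ⊛ g) n = Σ (suc n) (λ i → f i * g (n ∸ i))

𝟘 : Series
𝟘 _ = 0ℚ

𝟙 : Series
𝟙 zero    = 1ℚ
𝟙 (suc _) = 0ℚ

⊛-cong : ∀ {f f′ g g′} → f ≋ f′ → g ≋ g′ → f ⊛ g ≋ f′ ⊛ g′
⊛-cong f≋f′ g≋g′ n = Σ-cong (suc n) (λ i _ → cong₂ _*_ (f≋f′ i) (g≋g′ (n ∸ i)))

⊛-congˡ : ∀ {f f′} g → f ≋ f′ → f ⊛ g ≋ f′ ⊛ g
⊛-congˡ g f≋f′ = ⊛-cong {g = g} f≋f′ (λ _ → refl)

⊛-congʳ : ∀ f {g g′} → g ≋ g′ → f ⊛ g ≋ f ⊛ g′
⊛-congʳ f g≋g′ = ⊛-cong {f} (λ _ → refl) g≋g′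

⊛-comm : ∀ f g → f ⊛ g ≋ g ⊛ f
⊛-comm f g n = trans (Σ-reverse n (λ i → f i * g (n ∸ i))) (Σ-cong (suc n) λ i i≤n →
  trans (ℚₚ.*-comm (f (n ∸ i)) (g (n ∸ (n ∸ i))))
        (cong (λ j → g j * f (n ∸ i)) (ℕₚ.m∸[m∸n]≡n (ℕₚ.≤-pred i≤n))))

⊛-distribʳ : ∀ h f g → (f ⊕ g) ⊛ h ≋ f ⊛ h ⊕ g ⊛ h
⊛-distribʳ h f g n = trans (Σ-cong (suc n) (λ i _ → ℚₚ.*-distribʳ-+ (h (n ∸ i)) (f i) (g i)))
                           (Σ-+ (suc n) (λ i → f i * h (n ∸ i)) (λ i → g i * h (n ∸ i)))

⊛-zeroˡ : ∀ f → 𝟘 ⊛ f ≋ 𝟘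
⊛-zeroˡ f n = Σ-zero (suc n) (λ i _ → ℚₚ.*-zeroˡ (f (n ∸ i)))

⊛-identityˡ : ∀ f → 𝟙 ⊛ f ≋ f
⊛-identityˡ f n = trans (cong₂ _+_ (ℚₚ.*-identityˡ (f n)) (Σ-zero n (λ i _ → ℚₚ.*-zeroˡ (f (n ∸ suc i)))))
                        (ℚₚ.+-identityʳ (f n))

-- Induction on the degree: the coefficient of t^(n+1) in f ⊛ g is f₀ g_{n+1} plus the
-- coefficient of tⁿ in (f ∘ suc) ⊛ g.
⊛-assoc : ∀ f g h → (f ⊛ g) ⊛ h ≋ f ⊛ (g ⊛ h)
⊛-assoc f g h zero = begin
  (f 0 * g 0 + 0ℚ) * h 0 + 0ℚ ≡⟨ cong (λ x → x * h 0 + 0ℚ) (ℚₚ.+-identityʳ (f 0 * g 0)) ⟩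
  f 0 * g 0 * h 0 + 0ℚ        ≡⟨ cong (_+ 0ℚ) (ℚₚ.*-assoc (f 0) (g 0) (h 0)) ⟩
  f 0 * (g 0 * h 0) + 0ℚ      ≡⟨ cong (λ x → f 0 * x + 0ℚ) (ℚₚ.+-identityʳ (g 0 * h 0)) ⟨
  f 0 * (g 0 * h 0 + 0ℚ) + 0ℚ ∎
⊛-assoc f g h (suc n) = begin
  (f ⊛ g) 0 * h (suc n) + (fg′ ⊛ h) n
    ≡⟨ cong₂ (λ x y → x * h (suc n) + y) (ℚₚ.+-identityʳ (f 0 * g 0))
             (⊛-distribʳ h (λ k → f 0 * g (suc k)) (f′ ⊛ g) n) ⟩
  f 0 * g 0 * h (suc n) + (((λ k → f 0 * g (suc k)) ⊛ h) n + ((f′ ⊛ g) ⊛ h) n)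
    ≡⟨ cong₂ (λ x y → f 0 * g 0 * h (suc n) + (x + y)) scalar (⊛-assoc f′ g h n) ⟩
  f 0 * g 0 * h (suc n) + (f 0 * (g′ ⊛ h) n + (f′ ⊛ (g ⊛ h)) n)
    ≡⟨ solve 5 (λ a b c d e → a :* b :* c :+ (a :* d :+ e) := a :* (b :* c :+ d) :+ e) refl
               (f 0) (g 0) (h (suc n)) ((g′ ⊛ h) n) ((f′ ⊛ (g ⊛ h)) n) ⟩
  f 0 * (g 0 * h (suc n) + (g′ ⊛ h) n) + (f′ ⊛ (g ⊛ h)) n
    ∎
  where
  f′ g′ fg′ : Series
  f′ = f ∘ suc
  g′ = g ∘ suc
  fg′ k = f 0 * g (suc k) + (f′ ⊛ g) k
  scalar : ((λ k → f 0 * g (suc k)) ⊛ h) n ≡ f 0 * (g′ ⊛ h) n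
  scalar = trans (Σ-cong (suc n) (λ i _ → ℚₚ.*-assoc (f 0) (g (suc i)) (h (n ∸ i))))
                 (sym (Σ-*ˡ (suc n) (f 0) (λ i → g (suc i) * h (n ∸ i))))

series-commutativeSemiring : CommutativeSemiring 0ℓ 0ℓ
series-commutativeSemiring = record
  { Carrier = Series ; _≈_ = _≋_ ; _+_ = _⊕_ ; _*_ = _⊛_ ; 0# = 𝟘 ; 1# = 𝟙
  ; isCommutativeSemiring = Biased.IsCommutativeSemiringˡ.isCommutativeSemiring record
    { +-isCommutativeMonoid = Pointwise.isCommutativeMonoid ℚₚ.+-0-isCommutativeMonoid
    ; *-isCommutativeMonoid = Biased.isCommutativeMonoidˡ record
      { isSemigroup = record
        { isMagma = record { isEquivalence = Pointwise.isEquivalence isEquivalence ; ∙-cong = ⊛-cong }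
        ; assoc   = ⊛-assoc
        }
      ; identityˡ = ⊛-identityˡ
      ; comm      = ⊛-comm
      }
    ; distribʳ = ⊛-distribʳ
    ; zeroˡ    = ⊛-zeroˡ
    }
  }
  where module Pointwise = Algebra.Construct.Pointwise ℕ

open CommutativeSemiring series-commutativeSemiring using (semiring)
open import Algebra.Properties.Semiring.Exp semiring using (_^_; ^-congˡ)
import Algebra.Properties.Semiring.Mult semiring as SeriesMult
import Algebra.Properties.Semiring.Sum semiring as SeriesSum
import Algebra.Properties.CommutativeSemiring.Binomial series-commutativeSemiring as Binomial

×-coeff : ∀ c f n → (c SeriesMult.× f) n ≡ ℕtoℚ c * f n
×-coeff zero    f n = sym (ℚₚ.*-zeroˡ (f n))
×-coeff (suc c) f n = begin
  f n + (c SeriesMult.× f) n ≡⟨ cong₂ _+_ (ℚₚ.*-identityˡ (f n)) (sym (×-coeff c f n)) ⟨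
  1ℚ * f n + ℕtoℚ c * f n    ≡⟨ ℚₚ.*-distribʳ-+ (f n) 1ℚ (ℕtoℚ c) ⟨
  (1ℚ + ℕtoℚ c) * f n        ≡⟨ cong (_* f n) (ℕtoℚ-+ 1 c) ⟨
  ℕtoℚ (suc c) * f n         ∎

sum-coeff : ∀ {k} (G : Fin k → Series) n → SeriesSum.sum G n ≡ sum (λ i → G i n)
sum-coeff {zero}  G n = refl
sum-coeff {suc k} G n = cong (G Fin.zero n +_) (sum-coeff (G ∘ Fin.suc) n)

binomial-coeff : ∀ f g k n → ((f ⊕ g) ^ k) n ≡ Σ (suc k) (λ a → ℕtoℚ (k C a) * ((f ^ a) ⊛ (g ^ (k ∸ a))) n)
binomial-coeff f g k n = begin
  ((f ⊕ g) ^ k) n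
    ≡⟨ Binomial.theorem k f g n ⟩
  SeriesSum.sum (Binomial.binomialTerm f g k) n
    ≡⟨ sum-coeff (Binomial.binomialTerm f g k) n ⟩
  sum (λ a → Binomial.binomialTerm f g k a n)
    ≡⟨ sum-cong-≗ {suc k} (λ a → ×-coeff (k C toℕ a) ((f ^ toℕ a) ⊛ (g ^ (k ∸ toℕ a))) n) ⟩
  Σ (suc k) (λ a → ℕtoℚ (k C a) * ((f ^ a) ⊛ (g ^ (k ∸ a))) n)
    ∎

monomial : ℚ → ℕ → Series
monomial c s i = ⟦ s ℕ.≟ i ⟧ * c

monomial-⊛ : ∀ c s h n → (monomial c s ⊛ h) n ≡ ⟦ s ≤? n ⟧ * (c * h (n ∸ s))
monomial-⊛ c s h n = begin
  Σ (suc n) (λ i → ⟦ s ℕ.≟ i ⟧ * c * h (n ∸ i))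
    ≡⟨ Σ-cong (suc n) (λ i _ → ℚₚ.*-assoc ⟦ s ℕ.≟ i ⟧ c (h (n ∸ i))) ⟩
  Σ (suc n) (λ i → ⟦ s ℕ.≟ i ⟧ * (c * h (n ∸ i)))
    ≡⟨ Σ-δ n s (λ i → c * h (n ∸ i)) ⟩
  ⟦ s ≤? n ⟧ * (c * h (n ∸ s))
    ∎

m+n≡o⇔m≤o×n≡o∸m : ∀ {m n o} → m ℕ.+ n ≡ o ⇔ (m ≤ o × n ≡ o ∸ m)
m+n≡o⇔m≤o×n≡o∸m {m} {n} = mk⇔
  (λ { refl → ℕₚ.m≤m+n m n , sym (ℕₚ.m+n∸m≡n m n) })
  (λ { (m≤o , refl) → ℕₚ.m+[n∸m]≡n m≤o })

monomial-^ : ∀ c s a → monomial c s ^ a ≋ monomial (c ^ℚ a) (a ℕ.* s)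
monomial-^ c s zero    zero    = sym (ℚₚ.*-identityˡ 1ℚ)
monomial-^ c s zero    (suc n) = sym (ℚₚ.*-zeroˡ 1ℚ)
monomial-^ c s (suc a) n = begin
  (monomial c s ⊛ monomial c s ^ a) n
    ≡⟨ ⊛-congʳ (monomial c s) (monomial-^ c s a) n ⟩
  (monomial c s ⊛ monomial (c ^ℚ a) (a ℕ.* s)) n
    ≡⟨ monomial-⊛ c s (monomial (c ^ℚ a) (a ℕ.* s)) n ⟩
  ⟦ s ≤? n ⟧ * (c * (⟦ a ℕ.* s ℕ.≟ n ∸ s ⟧ * c ^ℚ a))
    ≡⟨ solve 4 (λ x c y d → x :* (c :* (y :* d)) := (x :* y) :* (c :* d)) refl
               ⟦ s ≤? n ⟧ c ⟦ a ℕ.* s ℕ.≟ n ∸ s ⟧ (c ^ℚ a) ⟩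
  ⟦ s ≤? n ⟧ * ⟦ a ℕ.* s ℕ.≟ n ∸ s ⟧ * (c * c ^ℚ a)
    ≡⟨ cong (_* (c * c ^ℚ a)) (⟦⟧-× (s ≤? n) (a ℕ.* s ℕ.≟ n ∸ s)) ⟨
  ⟦ (s ≤? n) ×-dec (a ℕ.* s ℕ.≟ n ∸ s) ⟧ * (c * c ^ℚ a)
    ≡⟨ cong (_* (c * c ^ℚ a))
            (⟦⟧-⇔ m+n≡o⇔m≤o×n≡o∸m (s ℕ.+ a ℕ.* s ℕ.≟ n) ((s ≤? n) ×-dec (a ℕ.* s ℕ.≟ n ∸ s))) ⟨
  ⟦ s ℕ.+ a ℕ.* s ℕ.≟ n ⟧ * (c * c ^ℚ a)
    ∎

monomial-^-⊛ : ∀ c s a h n → ((monomial c s ^ a) ⊛ h) n ≡ ⟦ a ℕ.* s ≤? n ⟧ * (c ^ℚ a * h (n ∸ a ℕ.* s))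
monomial-^-⊛ c s a h n = trans (⊛-congˡ h (monomial-^ c s a) n) (monomial-⊛ (c ^ℚ a) (a ℕ.* s) h n)

^-vanishes : ∀ f → f 0 ≡ 0ℚ → ∀ k {n} → n < k → (f ^ k) n ≡ 0ℚ
^-vanishes f f₀≡0 (suc k) {n} n<1+k = Σ-zero (suc n) term
  where
  term : ∀ i → i < suc n → f i * (f ^ k) (n ∸ i) ≡ 0ℚ
  term zero    _       = trans (cong (_* (f ^ k) n) f₀≡0) (ℚₚ.*-zeroˡ ((f ^ k) n))
  term (suc i) 1+i≤1+n = trans (cong (f (suc i) *_) (^-vanishes f f₀≡0 k n∸1+i<k)) (ℚₚ.*-zeroʳ (f (suc i)))
    where n∸1+i<k = ℕₚ.<-≤-trans (ℕₚ.∸-monoʳ-< (s≤s z≤n) (ℕₚ.≤-pred 1+i≤1+n)) (ℕₚ.≤-pred n<1+k)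

-- Each factor of f^(k+1) contributes degree at least 1, so in degree ≤ d + k only the
-- coefficients of f up to degree d enter.
^-agree : ∀ {f g d} → f 0 ≡ 0ℚ → (∀ i → i ≤ d → f i ≡ g i) →
          ∀ k {n} → n ≤ d ℕ.+ k → (f ^ suc k) n ≡ (g ^ suc k) n
^-agree {f} {g} {d} f₀≡0 f≡g zero {n} n≤d+0 = Σ-cong (suc n) λ i i≤n →
  cong (_* 𝟙 (n ∸ i)) (f≡g i (ℕₚ.≤-trans (ℕₚ.≤-pred i≤n) (subst (n ≤_) (ℕₚ.+-identityʳ d) n≤d+0)))
^-agree {f} {g} {d} f₀≡0 f≡g (suc k) {n} n≤d+1+k = Σ-cong (suc n) term
  where
  g₀≡0 = trans (sym (f≡g 0 z≤n)) f₀≡0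
  vanish : ∀ h → h 0 ≡ 0ℚ → ∀ i {j} → j < suc k → h i * (h ^ suc k) j ≡ 0ℚ
  vanish h h₀≡0 i j<1+k = trans (cong (h i *_) (^-vanishes h h₀≡0 (suc k) j<1+k)) (ℚₚ.*-zeroʳ (h i))
  term : ∀ i → i < suc n → f i * (f ^ suc k) (n ∸ i) ≡ g i * (g ^ suc k) (n ∸ i)
  term zero _ = begin
    f 0 * (f ^ suc k) n ≡⟨ cong (_* (f ^ suc k) n) f₀≡0 ⟩
    0ℚ * (f ^ suc k) n  ≡⟨ ℚₚ.*-zeroˡ ((f ^ suc k) n) ⟩
    0ℚ                  ≡⟨ ℚₚ.*-zeroˡ ((g ^ suc k) n) ⟨
    0ℚ * (g ^ suc k) n  ≡⟨ cong (_* (g ^ suc k) n) g₀≡0 ⟨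
    g 0 * (g ^ suc k) n ∎
  term (suc i) 1+i≤1+n with suc i ≤? d
  ... | yes 1+i≤d = cong₂ _*_ (f≡g (suc i) 1+i≤d) (^-agree f₀≡0 f≡g k n∸1+i≤d+k)
    where
    n∸1+i≤d+k = ℕₚ.≤-trans (ℕₚ.∸-monoʳ-≤ n (s≤s z≤n))
                           (ℕₚ.m≤n+o⇒m∸n≤o n 1 (subst (n ≤_) (ℕₚ.+-suc d k) n≤d+1+k))
  ... | no  1+i≰d = trans (vanish f f₀≡0 (suc i) n∸1+i<1+k) (sym (vanish g g₀≡0 (suc i) n∸1+i<1+k))
    where
    d≤i = ℕₚ.≤-pred (ℕₚ.≰⇒> 1+i≰d)
    n∸1+i<1+k = s≤s (ℕₚ.m≤n+o⇒m∸n≤o n (suc i) (ℕₚ.≤-trans n≤d+1+k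
                  (subst (_≤ suc i ℕ.+ k) (sym (ℕₚ.+-suc d k)) (s≤s (ℕₚ.+-monoˡ-≤ k d≤i)))))

𝟙^k≋𝟙 : ∀ k → 𝟙 ^ k ≋ 𝟙
𝟙^k≋𝟙 zero    _ = refl
𝟙^k≋𝟙 (suc k) n = trans (⊛-identityˡ (𝟙 ^ k) n) (𝟙^k≋𝟙 k n)

[f⊕𝟙]^l-coeff : ∀ f l n → ((f ⊕ 𝟙) ^ l) (suc n) ≡ Σ l (λ i → ℕtoℚ (l C suc i) * (f ^ suc i) (suc n))
[f⊕𝟙]^l-coeff f l n = begin
  ((f ⊕ 𝟙) ^ l) (suc n)
    ≡⟨ binomial-coeff f 𝟙 l (suc n) ⟩
  Σ (suc l) (λ a → ℕtoℚ (l C a) * ((f ^ a) ⊛ (𝟙 ^ (l ∸ a))) (suc n))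
    ≡⟨ Σ-cong (suc l) (λ a _ → cong (ℕtoℚ (l C a) *_) (drop-𝟙 a)) ⟩
  ℕtoℚ (l C 0) * 0ℚ + Σ l F
    ≡⟨ cong (_+ Σ l F) (ℚₚ.*-zeroʳ (ℕtoℚ (l C 0))) ⟩
  0ℚ + Σ l F
    ≡⟨ ℚₚ.+-identityˡ (Σ l F) ⟩
  Σ l F
    ∎
  where
  F : ℕ → ℚ
  F i = ℕtoℚ (l C suc i) * (f ^ suc i) (suc n)
  drop-𝟙 : ∀ a → ((f ^ a) ⊛ (𝟙 ^ (l ∸ a))) (suc n) ≡ (f ^ a) (suc n)
  drop-𝟙 a = trans (⊛-congʳ (f ^ a) (𝟙^k≋𝟙 (l ∸ a)) (suc n))
                   (trans (⊛-comm (f ^ a) 𝟙 (suc n)) (⊛-identityˡ (f ^ a) (suc n)))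

-- Bell polynomials

egf : (ℕ → ℚ) → Series
egf x i = x i * inv! i

egf⁺ : (ℕ → ℚ) → Series
egf⁺ x zero    = 0ℚ
egf⁺ x (suc i) = egf x (suc i)

egf≋egf⁺⊕𝟙 : ∀ x → x 0 ≡ 1ℚ → egf x ≋ egf⁺ x ⊕ 𝟙
egf≋egf⁺⊕𝟙 x x₀≡1 zero    = trans (cong (_* 1ℚ) x₀≡1) (trans (ℚₚ.*-identityʳ 1ℚ) (sym (ℚₚ.+-identityˡ 1ℚ)))
egf≋egf⁺⊕𝟙 x x₀≡1 (suc i) = sym (ℚₚ.+-identityʳ (egf x (suc i)))

indexedBy : (ℕ → ℕ) → ∀ {L} → Vec ℕ L → List (ℕ × ℕ)
indexedBy f []      = []
indexedBy f (a ∷ α) = (f 0 , a) ∷ indexedBy (f ∘ suc) α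

indexed≡indexedBy-suc : ∀ {L} (α : Vec ℕ L) → indexed α ≡ indexedBy suc α
indexed≡indexedBy-suc α = trans (Listₚ.map-tabulate (λ j → j) _) (tabulate≡indexedBy suc α)
  where
  tabulate≡indexedBy : ∀ f {L} (α : Vec ℕ L) → tabulate (λ j → f (toℕ j) , lookup α j) ≡ indexedBy f α
  tabulate≡indexedBy f []      = refl
  tabulate≡indexedBy f (a ∷ α) = cong ((f 0 , a) ∷_) (tabulate≡indexedBy (f ∘ suc) α)

size weight : List (ℕ × ℕ) → ℕ
size   ps = sumNat (map proj₂ ps)
weight ps = sumNat (map (λ p → proj₁ p ℕ.* proj₂ p) ps)

Admits : ℕ → ℕ → List (ℕ × ℕ) → Set
Admits k n ps = size ps ≡ k × weight ps ≡ n

admits? : ∀ k n ps → Dec (Admits k n ps)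
admits? k n ps = (size ps ℕ.≟ k) ×-dec (weight ps ℕ.≟ n)

⟦admits⟧-∷ : ∀ k n i a ps → ⟦ admits? k n ((i , a) ∷ ps) ⟧ ≡
             ⟦ a ≤? k ⟧ * (⟦ a ℕ.* i ≤? n ⟧ * ⟦ admits? (k ∸ a) (n ∸ a ℕ.* i) ps ⟧)
⟦admits⟧-∷ k n i a ps rewrite ℕₚ.*-comm a i = begin
  ⟦ (a ℕ.+ s ℕ.≟ k) ×-dec (i ℕ.* a ℕ.+ w ℕ.≟ n) ⟧
    ≡⟨ ⟦⟧-× (a ℕ.+ s ℕ.≟ k) (i ℕ.* a ℕ.+ w ℕ.≟ n) ⟩
  ⟦ a ℕ.+ s ℕ.≟ k ⟧ * ⟦ i ℕ.* a ℕ.+ w ℕ.≟ n ⟧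
    ≡⟨ cong₂ _*_ (⟦⟧-⇔ m+n≡o⇔m≤o×n≡o∸m (a ℕ.+ s ℕ.≟ k) ((a ≤? k) ×-dec (s ℕ.≟ k ∸ a)))
                 (⟦⟧-⇔ m+n≡o⇔m≤o×n≡o∸m (i ℕ.* a ℕ.+ w ℕ.≟ n) ((i ℕ.* a ≤? n) ×-dec (w ℕ.≟ n ∸ i ℕ.* a))) ⟩
  ⟦ (a ≤? k) ×-dec (s ℕ.≟ k ∸ a) ⟧ * ⟦ (i ℕ.* a ≤? n) ×-dec (w ℕ.≟ n ∸ i ℕ.* a) ⟧
    ≡⟨ cong₂ _*_ (⟦⟧-× (a ≤? k) (s ℕ.≟ k ∸ a)) (⟦⟧-× (i ℕ.* a ≤? n) (w ℕ.≟ n ∸ i ℕ.* a)) ⟩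
  ⟦ a ≤? k ⟧ * ⟦ s ℕ.≟ k ∸ a ⟧ * (⟦ i ℕ.* a ≤? n ⟧ * ⟦ w ℕ.≟ n ∸ i ℕ.* a ⟧)
    ≡⟨ solve 4 (λ p q r t → p :* q :* (r :* t) := p :* (r :* (q :* t))) refl
               ⟦ a ≤? k ⟧ ⟦ s ℕ.≟ k ∸ a ⟧ ⟦ i ℕ.* a ≤? n ⟧ ⟦ w ℕ.≟ n ∸ i ℕ.* a ⟧ ⟩
  ⟦ a ≤? k ⟧ * (⟦ i ℕ.* a ≤? n ⟧ * (⟦ s ℕ.≟ k ∸ a ⟧ * ⟦ w ℕ.≟ n ∸ i ℕ.* a ⟧))
    ≡⟨ cong (λ z → ⟦ a ≤? k ⟧ * (⟦ i ℕ.* a ≤? n ⟧ * z)) (⟦⟧-× (s ℕ.≟ k ∸ a) (w ℕ.≟ n ∸ i ℕ.* a)) ⟨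
  ⟦ a ≤? k ⟧ * (⟦ i ℕ.* a ≤? n ⟧ * ⟦ admits? (k ∸ a) (n ∸ i ℕ.* a) ps ⟧)
    ∎
  where
  s = size ps
  w = weight ps

bellFactor : (ℕ → ℚ) → ℕ × ℕ → ℚ
bellFactor x (i , a) = inv! a * egf x i ^ℚ a

bellProduct : (ℕ → ℚ) → (ℕ → ℕ) → ∀ {L} → Vec ℕ L → ℚ
bellProduct x f α = prodℚ (map (bellFactor x) (indexedBy f α))

admitsBy? : ∀ f k n {L} (α : Vec ℕ L) → Dec (Admits k n (indexedBy f α))
admitsBy? f k n α = admits? k n (indexedBy f α)

-- The sum defining B_{n,k}(x) / n!, generalised to multiplicities α_j ∈ [0, N] of the indices f j.
bellSum : (ℕ → ℚ) → (N : ℕ) → (ℕ → ℕ) → (L k n : ℕ) → ℚ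
bellSum x N f L k n = sumℚ (map (bellProduct x f) (filter (admitsBy? f k n) (allVecs (upTo (suc N)) L)))

bell≡n!*bellSum : ∀ n k x → bell n k x ≡ ℕtoℚ (n !) * bellSum x n suc (suc (n ∸ k)) k n
bell≡n!*bellSum n k x = begin
  sumℚ (map (bellTerm n x) (filter (admissible? n k) αs))
    ≡⟨ cong (λ βs → sumℚ (map (bellTerm n x) βs))
            (Listₚ.filter-≐ (admissible? n k) (admitsBy? suc k n)
                            ((λ {α} → subst (Admits k n) (indexed≡indexedBy-suc α)) ,
                             (λ {α} → subst (Admits k n) (sym (indexed≡indexedBy-suc α)))) αs) ⟩
  sumℚ (map (bellTerm n x) βs)
    ≡⟨ cong sumℚ (Listₚ.map-cong (λ α → cong (ℕtoℚ (n !) *_) (bellTerm-product α)) βs) ⟩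
  sumℚ (map (λ α → ℕtoℚ (n !) * bellProduct x suc α) βs)
    ≡⟨ sumℚ-*ˡ (ℕtoℚ (n !)) (bellProduct x suc) βs ⟨
  ℕtoℚ (n !) * bellSum x n suc (suc (n ∸ k)) k n
    ∎
  where
  αs = allVecs (upTo (suc n)) (suc (n ∸ k))
  βs = filter (admitsBy? suc k n) αs
  bellTerm-product : ∀ {L} (α : Vec ℕ L) →
    prodℚ (map (λ p → (1ℚ * inv! (proj₂ p)) * ((x (proj₁ p) * (1ℚ * inv! (proj₁ p))) ^ℚ proj₂ p)) (indexed α))
      ≡ bellProduct x suc α
  bellTerm-product α = cong prodℚ (trans
    (Listₚ.map-cong (λ { (i , a) → cong₂ (λ u v → u * (x i * v) ^ℚ a) (ℚₚ.*-identityˡ (inv! a)) (ℚₚ.*-identityˡ (inv! i)) })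
                    (indexed α))
    (cong (map (bellFactor x)) (indexed≡indexedBy-suc α)))

bellSum-cons : ∀ x N f L k n → bellSum x N f (suc L) k n ≡
  Σ (suc N) (λ a → ⟦ a ≤? k ⟧ * (⟦ a ℕ.* f 0 ≤? n ⟧ *
                    (bellFactor x (f 0 , a) * bellSum x N (f ∘ suc) L (k ∸ a) (n ∸ a ℕ.* f 0))))
bellSum-cons x N f L k n = begin
  sumℚ (map (bellProduct x f) (filter (admitsBy? f k n) (concatMap (λ a → map (a ∷_) αs) (upTo (suc N)))))
    ≡⟨ sumℚ-filter (admitsBy? f k n) (bellProduct x f) (concatMap (λ a → map (a ∷_) αs) (upTo (suc N))) ⟩
  sumℚ (map F (concatMap (λ a → map (a ∷_) αs) (upTo (suc N))))
    ≡⟨ sumℚ-concatMap F (λ a → map (a ∷_) αs) (upTo (suc N)) ⟩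
  sumℚ (map (λ a → sumℚ (map F (map (a ∷_) αs))) (upTo (suc N)))
    ≡⟨ sumℚ-applyUpTo (λ a → sumℚ (map F (map (a ∷_) αs))) (λ a → a) (suc N) ⟩
  Σ (suc N) (λ a → sumℚ (map F (map (a ∷_) αs)))
    ≡⟨ Σ-cong (suc N) (λ a _ → first-entry a) ⟩
  Σ (suc N) (λ a → c₁ a * (c₂ a * (bellFactor x (f 0 , a) * bellSum x N (f ∘ suc) L (k ∸ a) (n ∸ a ℕ.* f 0))))
    ∎
  where
  αs = allVecs (upTo (suc N)) L
  F : Vec ℕ (suc L) → ℚ
  F α = ⟦ admitsBy? f k n α ⟧ * bellProduct x f α
  c₁ c₂ : ℕ → ℚ
  c₁ a = ⟦ a ≤? k ⟧
  c₂ a = ⟦ a ℕ.* f 0 ≤? n ⟧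
  first-entry : ∀ a → sumℚ (map F (map (a ∷_) αs)) ≡
    c₁ a * (c₂ a * (bellFactor x (f 0 , a) * bellSum x N (f ∘ suc) L (k ∸ a) (n ∸ a ℕ.* f 0)))
  first-entry a = begin
    sumℚ (map F (map (a ∷_) αs))
      ≡⟨ cong sumℚ (Listₚ.map-∘ αs) ⟨
    sumℚ (map (λ α → F (a ∷ α)) αs)
      ≡⟨ cong sumℚ (Listₚ.map-cong split αs) ⟩
    sumℚ (map (λ α → c₁ a * (c₂ a * (t * G α))) αs)
      ≡⟨ sumℚ-*ˡ (c₁ a) _ αs ⟨
    c₁ a * sumℚ (map (λ α → c₂ a * (t * G α)) αs)
      ≡⟨ cong (c₁ a *_) (trans (sym (sumℚ-*ˡ (c₂ a) _ αs)) (cong (c₂ a *_) (sym (sumℚ-*ˡ t G αs)))) ⟩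
    c₁ a * (c₂ a * (t * sumℚ (map G αs)))
      ≡⟨ cong (λ z → c₁ a * (c₂ a * (t * z))) (sumℚ-filter (admitsBy? (f ∘ suc) (k ∸ a) (n ∸ a ℕ.* f 0))
                                                             (bellProduct x (f ∘ suc)) αs) ⟨
    c₁ a * (c₂ a * (t * bellSum x N (f ∘ suc) L (k ∸ a) (n ∸ a ℕ.* f 0)))
      ∎
    where
    t = bellFactor x (f 0 , a)
    G : Vec ℕ L → ℚ
    G α = ⟦ admitsBy? (f ∘ suc) (k ∸ a) (n ∸ a ℕ.* f 0) α ⟧ * bellProduct x (f ∘ suc) α
    split : ∀ α → F (a ∷ α) ≡ c₁ a * (c₂ a * (t * G α))
    split α = begin
      ⟦ admitsBy? f k n (a ∷ α) ⟧ * (t * bellProduct x (f ∘ suc) α)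
        ≡⟨ cong (_* (t * bellProduct x (f ∘ suc) α)) (⟦admits⟧-∷ k n (f 0) a (indexedBy (f ∘ suc) α)) ⟩
      c₁ a * (c₂ a * g) * (t * bellProduct x (f ∘ suc) α)
        ≡⟨ solve 5 (λ u v w y z → u :* (v :* w) :* (y :* z) := u :* (v :* (y :* (w :* z)))) refl
                   (c₁ a) (c₂ a) g t (bellProduct x (f ∘ suc) α) ⟩
      c₁ a * (c₂ a * (t * G α))
        ∎
      where g = ⟦ admitsBy? (f ∘ suc) (k ∸ a) (n ∸ a ℕ.* f 0) α ⟧

egfPart : (ℕ → ℚ) → (ℕ → ℕ) → ℕ → Series
egfPart x f zero    = 𝟘
egfPart x f (suc L) = monomial (egf x (f 0)) (f 0) ⊕ egfPart x (f ∘ suc) L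

k!*bellSum≡coeff : ∀ x N f L k n → k ≤ N → ℕtoℚ (k !) * bellSum x N f L k n ≡ (egfPart x f L ^ k) n
k!*bellSum≡coeff x N f zero    zero    zero    _   = trans (ℚₚ.*-identityˡ (1ℚ + 0ℚ)) (ℚₚ.+-identityʳ 1ℚ)
k!*bellSum≡coeff x N f zero    zero    (suc n) _   = ℚₚ.*-zeroʳ 1ℚ
k!*bellSum≡coeff x N f zero    (suc k) n       _   = trans (ℚₚ.*-zeroʳ (ℕtoℚ (suc k !))) (sym (⊛-zeroˡ (𝟘 ^ k) n))
k!*bellSum≡coeff x N f (suc L) k       n       k≤N = begin
  ℕtoℚ (k !) * bellSum x N f (suc L) k n
    ≡⟨ cong (ℕtoℚ (k !) *_) (bellSum-cons x N f L k n) ⟩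
  ℕtoℚ (k !) * Σ (suc N) (λ a → ⟦ a ≤? k ⟧ * G a)
    ≡⟨ Σ-*ˡ (suc N) (ℕtoℚ (k !)) (λ a → ⟦ a ≤? k ⟧ * G a) ⟩
  Σ (suc N) (λ a → ℕtoℚ (k !) * (⟦ a ≤? k ⟧ * G a))
    ≡⟨ Σ-cong (suc N) (λ a _ → ℚ-*.x∙yz≈y∙xz (ℕtoℚ (k !)) ⟦ a ≤? k ⟧ (G a)) ⟩
  Σ (suc N) (λ a → ⟦ a ≤? k ⟧ * (ℕtoℚ (k !) * G a))
    ≡⟨ Σ-restrict (λ a → ℕtoℚ (k !) * G a) k≤N ⟩
  Σ (suc k) (λ a → ℕtoℚ (k !) * G a)
    ≡⟨ Σ-cong (suc k) (λ a a≤k → term a (ℕₚ.≤-pred a≤k)) ⟩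
  Σ (suc k) (λ a → ℕtoℚ (k C a) * ((M ^ a) ⊛ (X′ ^ (k ∸ a))) n)
    ≡⟨ binomial-coeff M X′ k n ⟨
  ((M ⊕ X′) ^ k) n
    ∎
  where
  y  = egf x (f 0)
  M  = monomial y (f 0)
  X′ = egfPart x (f ∘ suc) L
  W G : ℕ → ℚ
  W a = bellSum x N (f ∘ suc) L (k ∸ a) (n ∸ a ℕ.* f 0)
  G a = ⟦ a ℕ.* f 0 ≤? n ⟧ * (bellFactor x (f 0 , a) * W a)
  term : ∀ a → a ≤ k → ℕtoℚ (k !) * G a ≡ ℕtoℚ (k C a) * ((M ^ a) ⊛ (X′ ^ (k ∸ a))) n
  term a a≤k = begin
    ℕtoℚ (k !) * (δ * (inv! a * y ^ℚ a * W a))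
      ≡⟨ solve 5 (λ K δ i c w → K :* (δ :* (i :* c :* w)) := (K :* i) :* (δ :* (c :* w))) refl
                 (ℕtoℚ (k !)) δ (inv! a) (y ^ℚ a) (W a) ⟩
    ℕtoℚ (k !) * inv! a * (δ * (y ^ℚ a * W a))
      ≡⟨ cong (_* (δ * (y ^ℚ a * W a))) (trans (n!*inv!k≡nCk*[n∸k]! a≤k) (ℕtoℚ-* (k C a) ((k ∸ a) !))) ⟩
    ℕtoℚ (k C a) * ℕtoℚ ((k ∸ a) !) * (δ * (y ^ℚ a * W a))
      ≡⟨ solve 5 (λ C F δ c w → C :* F :* (δ :* (c :* w)) := C :* (δ :* (c :* (F :* w)))) refl
                 (ℕtoℚ (k C a)) (ℕtoℚ ((k ∸ a) !)) δ (y ^ℚ a) (W a) ⟩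
    ℕtoℚ (k C a) * (δ * (y ^ℚ a * (ℕtoℚ ((k ∸ a) !) * W a)))
      ≡⟨ cong (λ z → ℕtoℚ (k C a) * (δ * (y ^ℚ a * z)))
              (k!*bellSum≡coeff x N (f ∘ suc) L (k ∸ a) (n ∸ a ℕ.* f 0) (ℕₚ.≤-trans (ℕₚ.m∸n≤m k a) k≤N)) ⟩
    ℕtoℚ (k C a) * (δ * (y ^ℚ a * (X′ ^ (k ∸ a)) (n ∸ a ℕ.* f 0)))
      ≡⟨ cong (ℕtoℚ (k C a) *_) (monomial-^-⊛ y (f 0) a (X′ ^ (k ∸ a)) n) ⟨
    ℕtoℚ (k C a) * ((M ^ a) ⊛ (X′ ^ (k ∸ a))) n
      ∎
    where δ = ⟦ a ℕ.* f 0 ≤? n ⟧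

egfPart-coeff : ∀ x f L i → egfPart x f L i ≡ Σ L (λ j → monomial (egf x (f j)) (f j) i)
egfPart-coeff x f zero    i = refl
egfPart-coeff x f (suc L) i = cong (monomial (egf x (f 0)) (f 0) i +_) (egfPart-coeff x (f ∘ suc) L i)

egfPart≡egf⁺ : ∀ x L i → i ≤ suc L → egfPart x suc (suc L) i ≡ egf⁺ x i
egfPart≡egf⁺ x L zero    _         =
  trans (egfPart-coeff x suc (suc L) 0) (Σ-zero (suc L) (λ j _ → ℚₚ.*-zeroˡ (egf x (suc j))))
egfPart≡egf⁺ x L (suc i) (s≤s i≤L) = begin
  egfPart x suc (suc L) (suc i)                          ≡⟨ egfPart-coeff x suc (suc L) (suc i) ⟩
  Σ (suc L) (λ j → ⟦ suc j ℕ.≟ suc i ⟧ * egf x (suc j)) ≡⟨ Σ-cong (suc L) (λ j _ → cong (_* egf x (suc j)) (flip j)) ⟩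
  Σ (suc L) (λ j → ⟦ i ℕ.≟ j ⟧ * egf x (suc j))         ≡⟨ Σ-δ L i (egf x ∘ suc) ⟩
  ⟦ i ≤? L ⟧ * egf x (suc i)                             ≡⟨ cong (_* egf x (suc i)) (⟦⟧-yes (i ≤? L) i≤L) ⟩
  1ℚ * egf x (suc i)                                     ≡⟨ ℚₚ.*-identityˡ (egf x (suc i)) ⟩
  egf x (suc i)                                          ∎
  where
  flip : ∀ j → ⟦ suc j ℕ.≟ suc i ⟧ ≡ ⟦ i ℕ.≟ j ⟧
  flip j = ⟦⟧-⇔ (mk⇔ (λ e → ℕₚ.suc-injective (sym e)) (λ e → cong suc (sym e))) (suc j ℕ.≟ suc i) (i ℕ.≟ j)

bell*falling : ∀ x {n k} → k < n → ∀ l →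
  bell n (suc k) x * falling l (suc k) ≡ ℕtoℚ (n !) * (ℕtoℚ (l C suc k) * (egf⁺ x ^ suc k) n)
bell*falling x {n} {k} k<n l = begin
  bell n (suc k) x * falling l (suc k)
    ≡⟨ cong₂ _*_ (bell≡n!*bellSum n (suc k) x) (trans (falling≡nCk*k! l (suc k)) (ℕtoℚ-* (l C suc k) (suc k !))) ⟩
  ℕtoℚ (n !) * W * (ℕtoℚ (l C suc k) * ℕtoℚ (suc k !))
    ≡⟨ solve 4 (λ a w c f → a :* w :* (c :* f) := a :* (c :* (f :* w))) refl
               (ℕtoℚ (n !)) W (ℕtoℚ (l C suc k)) (ℕtoℚ (suc k !)) ⟩
  ℕtoℚ (n !) * (ℕtoℚ (l C suc k) * (ℕtoℚ (suc k !) * W))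
    ≡⟨ cong (λ z → ℕtoℚ (n !) * (ℕtoℚ (l C suc k) * z)) (k!*bellSum≡coeff x n suc L (suc k) n k<n) ⟩
  ℕtoℚ (n !) * (ℕtoℚ (l C suc k) * (egfPart x suc L ^ suc k) n)
    ≡⟨ cong (λ z → ℕtoℚ (n !) * (ℕtoℚ (l C suc k) * z))
            (^-agree (egfPart≡egf⁺ x (n ∸ suc k) 0 z≤n) (egfPart≡egf⁺ x (n ∸ suc k)) k n≤L+k) ⟩
  ℕtoℚ (n !) * (ℕtoℚ (l C suc k) * (egf⁺ x ^ suc k) n)
    ∎
  where
  L = suc (n ∸ suc k)
  W = bellSum x n suc L (suc k) n
  n≤L+k : n ≤ L ℕ.+ k
  n≤L+k = ℕₚ.≤-reflexive (trans (sym (ℕₚ.m∸n+n≡m k<n)) (ℕₚ.+-suc (n ∸ suc k) k))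

bell-falling-sum : ∀ x n → 1 ≤ n → ∀ l →
  sumFrom1 n (λ k → bell n k x * falling l k) ≡ ℕtoℚ (n !) * ((egf⁺ x ⊕ 𝟙) ^ l) n
bell-falling-sum x (suc n) _ l = begin
  sumFrom1 (suc n) (λ k → bell (suc n) k x * falling l k)
    ≡⟨ sumℚ-applyUpTo (λ i → bell (suc n) (suc i) x * falling l (suc i)) (λ i → i) (suc n) ⟩
  Σ (suc n) (λ i → bell (suc n) (suc i) x * falling l (suc i))
    ≡⟨ Σ-cong (suc n) (λ i i<n → bell*falling x i<n l) ⟩
  Σ (suc n) (λ i → ℕtoℚ (suc n !) * Φ i)
    ≡⟨ Σ-*ˡ (suc n) (ℕtoℚ (suc n !)) Φ ⟨
  ℕtoℚ (suc n !) * Σ (suc n) Φ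
    ≡⟨ cong (ℕtoℚ (suc n !) *_) (trans (sym (Σ-extend Φ (ℕₚ.m≤m+n (suc n) l) Φ-vanishes-beyond-n))
                                        (Σ-extend Φ (ℕₚ.m≤n+m l (suc n)) Φ-vanishes-beyond-l)) ⟩
  ℕtoℚ (suc n !) * Σ l Φ
    ≡⟨ cong (ℕtoℚ (suc n !) *_) ([f⊕𝟙]^l-coeff (egf⁺ x) l n) ⟨
  ℕtoℚ (suc n !) * ((egf⁺ x ⊕ 𝟙) ^ l) (suc n)
    ∎
  where
  Φ : ℕ → ℚ
  Φ i = ℕtoℚ (l C suc i) * (egf⁺ x ^ suc i) (suc n)
  Φ-vanishes-beyond-n : ∀ i → suc n ≤ i → i < suc n ℕ.+ l → Φ i ≡ 0ℚ
  Φ-vanishes-beyond-n i n<i _ = trans (cong (ℕtoℚ (l C suc i) *_) (^-vanishes (egf⁺ x) refl (suc i) (s≤s n<i)))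
                                      (ℚₚ.*-zeroʳ (ℕtoℚ (l C suc i)))
  Φ-vanishes-beyond-l : ∀ i → l ≤ i → i < suc n ℕ.+ l → Φ i ≡ 0ℚ
  Φ-vanishes-beyond-l i l≤i _ = trans (cong (λ c → ℕtoℚ c * (egf⁺ x ^ suc i) (suc n)) (k>n⇒nCk≡0 (s≤s l≤i)))
                                      (ℚₚ.*-zeroˡ ((egf⁺ x ^ suc i) (suc n)))

-- Colourings of complete graphs

occurrences : ∀ {l} → Fin l → List (Fin l) → ℕ
occurrences j xs = length (filter (_≟ᶠ j) xs)

toList≡tabulate-lookup : ∀ {A : Set} {n} (c : Vec A n) → toList c ≡ tabulate (lookup c)
toList≡tabulate-lookup []      = refl
toList≡tabulate-lookup (a ∷ c) = cong (a ∷_) (toList≡tabulate-lookup c)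

occurrences-toList : ∀ {l n} (c : Vec (Fin l) n) j → occurrences j (toList c) ≡ ℕΣ.sum (λ u → ⟦ lookup c u ≟ᶠ j ⟧ℕ)
occurrences-toList c j =
  trans (cong (occurrences j) (toList≡tabulate-lookup c)) (length-filter-tabulate (_≟ᶠ j) (lookup c))

-- Removing the summand of v from the count of vertices coloured like v leaves exactly
-- the neighbours of v in K_n with that colour.
sameColNbrs+1≡occurrences : ∀ {l n} (c : Vec (Fin l) n) v →
                            sameColNbrs (K n) c v ℕ.+ 1 ≡ occurrences (lookup c v) (toList c)
sameColNbrs+1≡occurrences {l} {suc n} c v = begin
  sameColNbrs (K (suc n)) c v ℕ.+ 1
    ≡⟨ cong (ℕ._+ 1) (length-filter-tabulate neighbour? (λ u → u)) ⟩
  ℕΣ.sum neighbour ℕ.+ 1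
    ≡⟨ cong (ℕ._+ 1) (ℕΣ.sum-remove {i = v} neighbour) ⟩
  neighbour v ℕ.+ ℕΣ.sum (removeAt neighbour v) ℕ.+ 1
    ≡⟨ cong (λ z → z ℕ.+ ℕΣ.sum (removeAt neighbour v) ℕ.+ 1) (⟦⟧ℕ-no (neighbour? v) λ (v≢v , _) → v≢v refl) ⟩
  ℕΣ.sum (removeAt neighbour v) ℕ.+ 1
    ≡⟨ ℕₚ.+-comm (ℕΣ.sum (removeAt neighbour v)) 1 ⟩
  1 ℕ.+ ℕΣ.sum (removeAt neighbour v)
    ≡⟨ cong₂ ℕ._+_ (sym (⟦⟧ℕ-yes (same? v) refl)) (ℕΣ.sum-cong-≗ {n} λ u →
         ⟦⟧ℕ-⇔ (mk⇔ proj₂ (λ e → (λ v≡u → punchInᵢ≢i v u (sym v≡u)) , e))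
               (neighbour? (Fin.punchIn v u)) (same? (Fin.punchIn v u))) ⟩
  same v ℕ.+ ℕΣ.sum (removeAt same v)
    ≡⟨ ℕΣ.sum-remove {i = v} same ⟨
  ℕΣ.sum same
    ≡⟨ occurrences-toList c (lookup c v) ⟨
  occurrences (lookup c v) (toList c)
    ∎
  where
  same? : ∀ u → Dec (lookup c u ≡ lookup c v)
  same? u = lookup c u ≟ᶠ lookup c v
  neighbour? : ∀ u → Dec (Graph.Adj (K (suc n)) v u × lookup c u ≡ lookup c v)
  neighbour? u = Graph.adj? (K (suc n)) v u ×-dec same? u
  neighbour same : Fin (suc n) → ℕ
  neighbour u = ⟦ neighbour? u ⟧ℕ
  same      u = ⟦ same? u ⟧ℕ

good-K⇔ : ∀ {l n} m (c : Vec (Fin l) n) → 1 ≤ m → Good m (K n) c ⇔ (∀ j → occurrences j (toList c) ≤ m)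
good-K⇔ {l} {n} m c 1≤m = mk⇔ to from
  where
  to : Good m (K n) c → ∀ j → occurrences j (toList c) ≤ m
  to good j with any? (λ v → lookup c v ≟ᶠ j)
  ... | yes (v , refl) = subst (_≤ m) (sameColNbrs+1≡occurrences c v)
                           (subst (sameColNbrs (K n) c v ℕ.+ 1 ≤_) (ℕₚ.m∸n+n≡m 1≤m) (ℕₚ.+-monoˡ-≤ 1 (tabulate⁻ good v)))
  ... | no  ∄v         = subst (_≤ m) (sym unused) z≤n
    where
    unused : occurrences j (toList c) ≡ 0
    unused = trans (occurrences-toList c j)
                   (trans (ℕΣ.sum-cong-≗ (λ v → ⟦⟧ℕ-no (lookup c v ≟ᶠ j) (λ e → ∄v (v , e)))) (ℕΣ.sum-replicate-zero n))
  from : (∀ j → occurrences j (toList c) ≤ m) → Good m (K n) c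
  from bounded = tabulate⁺ λ v →
    ℕₚ.m+n≤o⇒m≤o∸n (sameColNbrs (K n) c v) (subst (_≤ m) (sym (sameColNbrs+1≡occurrences c v)) (bounded (lookup c v)))

strip : ∀ {l} → List (Fin (suc l)) → List (Fin l)
strip []               = []
strip (Fin.zero  ∷ xs) = strip xs
strip (Fin.suc y ∷ xs) = y ∷ strip xs

occurrences-strip : ∀ {l} (j : Fin l) xs → occurrences (Fin.suc j) xs ≡ occurrences j (strip xs)
occurrences-strip j []               = refl
occurrences-strip j (Fin.zero  ∷ xs) = occurrences-strip j xs
occurrences-strip j (Fin.suc y ∷ xs) with y ≟ᶠ j
... | yes _ = cong suc (occurrences-strip j xs)
... | no  _ = occurrences-strip j xs

-- colourWeight A xs = ∏_{j < l} A (occurrences j xs)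
colourWeight : ∀ {l} → (ℕ → ℚ) → List (Fin l) → ℚ
colourWeight {zero}  A xs = 1ℚ
colourWeight {suc l} A xs = A (occurrences Fin.zero xs) * colourWeight A (strip xs)

one[m]≡⟦≤⟧ : ∀ m i → one[ m ] i ≡ ⟦ i ≤? m ⟧
one[m]≡⟦≤⟧ m i with i ≤? m
... | yes i≤m = sym (⟦⟧-yes (i ≤? m) i≤m)
... | no  i≰m = sym (⟦⟧-no (i ≤? m) i≰m)

colourWeight-one[m] : ∀ {l} m (xs : List (Fin l)) → colourWeight one[ m ] xs ≡ ⟦ all? (λ j → occurrences j xs ≤? m) ⟧
colourWeight-one[m] {zero}  m xs = sym (⟦⟧-yes (all? (λ j → occurrences j xs ≤? m)) (λ ()))
colourWeight-one[m] {suc l} m xs = begin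
  one[ m ] (occurrences Fin.zero xs) * colourWeight one[ m ] (strip xs)
    ≡⟨ cong₂ _*_ (one[m]≡⟦≤⟧ m (occurrences Fin.zero xs)) (colourWeight-one[m] m (strip xs)) ⟩
  ⟦ zero≤m? ⟧ * ⟦ strip≤m? ⟧
    ≡⟨ ⟦⟧-× zero≤m? strip≤m? ⟨
  ⟦ zero≤m? ×-dec strip≤m? ⟧
    ≡⟨ ⟦⟧-⇔ (mk⇔ to from) (zero≤m? ×-dec strip≤m?) (all? (λ j → occurrences j xs ≤? m)) ⟩
  ⟦ all? (λ j → occurrences j xs ≤? m) ⟧
    ∎
  where
  zero≤m? = occurrences Fin.zero xs ≤? m
  strip≤m? = all? (λ j → occurrences j (strip xs) ≤? m)
  to : occurrences Fin.zero xs ≤ m × (∀ j → occurrences j (strip xs) ≤ m) → ∀ j → occurrences j xs ≤ m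
  to (zero≤m , _)       Fin.zero    = zero≤m
  to (_      , strip≤m) (Fin.suc j) = subst (_≤ m) (sym (occurrences-strip j xs)) (strip≤m j)
  from : (∀ j → occurrences j xs ≤ m) → occurrences Fin.zero xs ≤ m × (∀ j → occurrences j (strip xs) ≤ m)
  from all≤m = all≤m Fin.zero , λ j → subst (_≤ m) (occurrences-strip j xs) (all≤m (Fin.suc j))

vecSum : ∀ l n → (Vec (Fin l) n → ℚ) → ℚ
vecSum l n F = sumℚ (map F (allVecs (allFin l) n))

vecSum-suc : ∀ l n (F : Vec (Fin l) (suc n) → ℚ) → vecSum l (suc n) F ≡ sum (λ a → vecSum l n (F ∘ (a ∷_)))
vecSum-suc l n F = begin
  sumℚ (map F (concatMap (λ a → map (a ∷_) cs) (allFin l)))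
    ≡⟨ sumℚ-concatMap F (λ a → map (a ∷_) cs) (allFin l) ⟩
  sumℚ (map (λ a → sumℚ (map F (map (a ∷_) cs))) (allFin l))
    ≡⟨ cong sumℚ (Listₚ.map-cong (λ a → cong sumℚ (sym (Listₚ.map-∘ cs))) (allFin l)) ⟩
  sumℚ (map (λ a → vecSum l n (F ∘ (a ∷_))) (allFin l))
    ≡⟨ sumℚ-tabulate (λ a → vecSum l n (F ∘ (a ∷_))) (λ a → a) ⟩
  sum (λ a → vecSum l n (F ∘ (a ∷_)))
    ∎
  where cs = allVecs (allFin l) n

binomialConvolution : ℕ → (ℕ → ℚ) → (ℕ → ℚ) → ℚ
binomialConvolution n u v = Σ (suc n) (λ j → ℕtoℚ (n C j) * u j * v (n ∸ j))

binomialConvolution-congʳ : ∀ n u {v w} → (∀ p → v p ≡ w p) → binomialConvolution n u v ≡ binomialConvolution n u w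
binomialConvolution-congʳ n u v≡w = Σ-cong (suc n) (λ j _ → cong (ℕtoℚ (n C j) * u j *_) (v≡w (n ∸ j)))

binomialConvolution-sumʳ : ∀ n u {l} (V : Fin l → ℕ → ℚ) →
  sum (λ y → binomialConvolution n u (V y)) ≡ binomialConvolution n u (λ p → sum (λ y → V y p))
binomialConvolution-sumʳ n u {l} V = begin
  sum (λ y → Σ (suc n) (λ j → ℕtoℚ (n C j) * u j * V y (n ∸ j)))
    ≡⟨ ∑-comm {l} {suc n} (λ y j → ℕtoℚ (n C toℕ j) * u (toℕ j) * V y (n ∸ toℕ j)) ⟩
  Σ (suc n) (λ j → sum (λ y → ℕtoℚ (n C j) * u j * V y (n ∸ j)))
    ≡⟨ Σ-cong (suc n) (λ j _ → sym (*-distribˡ-sum {l} (ℕtoℚ (n C j) * u j) (λ y → V y (n ∸ j)))) ⟩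
  binomialConvolution n u (λ p → sum (λ y → V y p))
    ∎

binomialConvolution-suc : ∀ n u v →
  binomialConvolution (suc n) u v ≡ binomialConvolution n (u ∘ suc) v + binomialConvolution n u (v ∘ suc)
binomialConvolution-suc n u v = begin
  1ℚ * u 0 * v (suc n) + Σ (suc n) (λ j → ℕtoℚ (suc n C suc j) * u (suc j) * v (n ∸ j))
    ≡⟨ cong (1ℚ * u 0 * v (suc n) +_) (trans (Σ-cong (suc n) (λ j _ → pascal j))
                                             (Σ-+ (suc n) (λ j → ℕtoℚ (n C j) * u (suc j) * v (n ∸ j)) T)) ⟩
  1ℚ * u 0 * v (suc n) + (binomialConvolution n (u ∘ suc) v + Σ (suc n) T)
    ≡⟨ solve 3 (λ a b c → a :+ (b :+ c) := b :+ (a :+ c)) refl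
               (1ℚ * u 0 * v (suc n)) (binomialConvolution n (u ∘ suc) v) (Σ (suc n) T) ⟩
  binomialConvolution n (u ∘ suc) v + (1ℚ * u 0 * v (suc n) + Σ (suc n) T)
    ≡⟨ cong (λ z → binomialConvolution n (u ∘ suc) v + (1ℚ * u 0 * v (suc n) + z)) shifted ⟩
  binomialConvolution n (u ∘ suc) v + binomialConvolution n u (v ∘ suc)
    ∎
  where
  T : ℕ → ℚ
  T j = ℕtoℚ (n C suc j) * u (suc j) * v (n ∸ j)
  pascal : ∀ j → ℕtoℚ (suc n C suc j) * u (suc j) * v (n ∸ j) ≡ ℕtoℚ (n C j) * u (suc j) * v (n ∸ j) + T j
  pascal j = begin
    ℕtoℚ (suc n C suc j) * u (suc j) * v (n ∸ j)
      ≡⟨ cong (λ c → ℕtoℚ c * u (suc j) * v (n ∸ j)) (nCk+nC[k+1]≡[n+1]C[k+1] n j) ⟨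
    ℕtoℚ (n C j ℕ.+ n C suc j) * u (suc j) * v (n ∸ j)
      ≡⟨ cong (λ c → c * u (suc j) * v (n ∸ j)) (ℕtoℚ-+ (n C j) (n C suc j)) ⟩
    (ℕtoℚ (n C j) + ℕtoℚ (n C suc j)) * u (suc j) * v (n ∸ j)
      ≡⟨ solve 4 (λ a b c d → (a :+ b) :* c :* d := a :* c :* d :+ b :* c :* d) refl
                 (ℕtoℚ (n C j)) (ℕtoℚ (n C suc j)) (u (suc j)) (v (n ∸ j)) ⟩
    ℕtoℚ (n C j) * u (suc j) * v (n ∸ j) + T j
      ∎
  shifted : Σ (suc n) T ≡ Σ n (λ j → ℕtoℚ (n C suc j) * u (suc j) * v (suc (n ∸ suc j)))
  shifted = begin
    Σ (suc n) T
      ≡⟨ Σ-last n T ⟩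
    Σ n T + ℕtoℚ (n C suc n) * u (suc n) * v (n ∸ n)
      ≡⟨ cong₂ _+_ (Σ-cong n (λ j j<n → cong (λ i → ℕtoℚ (n C suc j) * u (suc j) * v i) (ℕₚ.+-∸-assoc 1 j<n)))
                   (cong (λ c → ℕtoℚ c * u (suc n) * v (n ∸ n)) (k>n⇒nCk≡0 (ℕₚ.n<1+n n))) ⟩
    Σ n (λ j → ℕtoℚ (n C suc j) * u (suc j) * v (suc (n ∸ suc j))) + 0ℚ * u (suc n) * v (n ∸ n)
      ≡⟨ cong (Σ n (λ j → ℕtoℚ (n C suc j) * u (suc j) * v (suc (n ∸ suc j))) +_)
              (trans (cong (_* v (n ∸ n)) (ℚₚ.*-zeroˡ (u (suc n)))) (ℚₚ.*-zeroˡ (v (n ∸ n)))) ⟩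
    Σ n (λ j → ℕtoℚ (n C suc j) * u (suc j) * v (suc (n ∸ suc j))) + 0ℚ
      ≡⟨ ℚₚ.+-identityʳ _ ⟩
    Σ n (λ j → ℕtoℚ (n C suc j) * u (suc j) * v (suc (n ∸ suc j)))
      ∎

binomialConvolution-factorial : ∀ n u v →
  binomialConvolution n u (λ p → ℕtoℚ (p !) * v p) ≡ ℕtoℚ (n !) * (egf u ⊛ v) n
binomialConvolution-factorial n u v = begin
  Σ (suc n) (λ j → ℕtoℚ (n C j) * u j * (ℕtoℚ ((n ∸ j) !) * v (n ∸ j)))
    ≡⟨ Σ-cong (suc n) (λ j j≤n → term j (ℕₚ.≤-pred j≤n)) ⟩
  Σ (suc n) (λ j → ℕtoℚ (n !) * (u j * inv! j * v (n ∸ j)))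
    ≡⟨ Σ-*ˡ (suc n) (ℕtoℚ (n !)) (λ j → u j * inv! j * v (n ∸ j)) ⟨
  ℕtoℚ (n !) * (egf u ⊛ v) n
    ∎
  where
  term : ∀ j → j ≤ n → ℕtoℚ (n C j) * u j * (ℕtoℚ ((n ∸ j) !) * v (n ∸ j)) ≡ ℕtoℚ (n !) * (u j * inv! j * v (n ∸ j))
  term j j≤n = begin
    ℕtoℚ (n C j) * u j * (ℕtoℚ ((n ∸ j) !) * v (n ∸ j))
      ≡⟨ solve 4 (λ c a f b → c :* a :* (f :* b) := c :* f :* (a :* b)) refl
                 (ℕtoℚ (n C j)) (u j) (ℕtoℚ ((n ∸ j) !)) (v (n ∸ j)) ⟩
    ℕtoℚ (n C j) * ℕtoℚ ((n ∸ j) !) * (u j * v (n ∸ j))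
      ≡⟨ cong (_* (u j * v (n ∸ j))) (trans (sym (ℕtoℚ-* (n C j) ((n ∸ j) !))) (sym (n!*inv!k≡nCk*[n∸k]! j≤n))) ⟩
    ℕtoℚ (n !) * inv! j * (u j * v (n ∸ j))
      ≡⟨ solve 4 (λ f i a b → f :* i :* (a :* b) := f :* (a :* i :* b)) refl (ℕtoℚ (n !)) (inv! j) (u j) (v (n ∸ j)) ⟩
    ℕtoℚ (n !) * (u j * inv! j * v (n ∸ j))
      ∎

-- Split a colouring with l + 1 colours into the positions of colour 0 and a colouring of
-- the remaining vertices with l colours.
vecSum-strip : ∀ {l} n (A : ℕ → ℚ) (Q : List (Fin l) → ℚ) →
  vecSum (suc l) n (λ c → A (occurrences Fin.zero (toList c)) * Q (strip (toList c)))
    ≡ binomialConvolution n A (λ p → vecSum l p (Q ∘ toList))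
vecSum-strip zero A Q = solve 2 (λ a q → a :* q :+ con 0ℚ := con 1ℚ :* a :* (q :+ con 0ℚ) :+ con 0ℚ) refl (A 0) (Q [])
vecSum-strip {l} (suc n) A Q = begin
  vecSum (suc l) (suc n) (λ c → A (occurrences Fin.zero (toList c)) * Q (strip (toList c)))
    ≡⟨ vecSum-suc (suc l) n _ ⟩
  vecSum (suc l) n (λ c → A (suc (occurrences Fin.zero (toList c))) * Q (strip (toList c)))
    + sum (λ y → vecSum (suc l) n (λ c → A (occurrences Fin.zero (toList c)) * Q (y ∷ strip (toList c))))
    ≡⟨ cong₂ _+_ (vecSum-strip n (A ∘ suc) Q) (sum-cong-≗ {l} (λ y → vecSum-strip n A (Q ∘ (y ∷_)))) ⟩
  binomialConvolution n (A ∘ suc) S + sum (λ y → binomialConvolution n A (S′ y))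
    ≡⟨ cong (binomialConvolution n (A ∘ suc) S +_) (binomialConvolution-sumʳ n A S′) ⟩
  binomialConvolution n (A ∘ suc) S + binomialConvolution n A (λ p → sum (λ y → S′ y p))
    ≡⟨ cong (binomialConvolution n (A ∘ suc) S +_) (binomialConvolution-congʳ n A (λ p → sym (vecSum-suc l p (Q ∘ toList)))) ⟩
  binomialConvolution n (A ∘ suc) S + binomialConvolution n A (S ∘ suc)
    ≡⟨ binomialConvolution-suc n A S ⟨
  binomialConvolution (suc n) A S
    ∎
  where
  S : ℕ → ℚ
  S p = vecSum l p (Q ∘ toList)
  S′ : Fin l → ℕ → ℚ
  S′ y p = vecSum l p (λ d → Q (y ∷ toList d))

vecSum-colourWeight : ∀ l n (A : ℕ → ℚ) → vecSum l n (colourWeight A ∘ toList) ≡ ℕtoℚ (n !) * (egf A ^ l) n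
vecSum-colourWeight zero    zero    A = trans (ℚₚ.+-identityʳ 1ℚ) (sym (ℚₚ.*-identityˡ 1ℚ))
vecSum-colourWeight zero    (suc n) A = sym (ℚₚ.*-zeroʳ (ℕtoℚ (suc n !)))
vecSum-colourWeight (suc l) n       A = begin
  vecSum (suc l) n (λ c → A (occurrences Fin.zero (toList c)) * colourWeight A (strip (toList c)))
    ≡⟨ vecSum-strip n A (colourWeight A) ⟩
  binomialConvolution n A (λ p → vecSum l p (colourWeight A ∘ toList))
    ≡⟨ binomialConvolution-congʳ n A (λ p → vecSum-colourWeight l p A) ⟩
  binomialConvolution n A (λ p → ℕtoℚ (p !) * (egf A ^ l) p)
    ≡⟨ binomialConvolution-factorial n A (egf A ^ l) ⟩
  ℕtoℚ (n !) * (egf A ^ suc l) n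
    ∎

degChrom-K≡coeff : ∀ m n l → 1 ≤ m → ℕtoℚ (degChrom m (K n) l) ≡ ℕtoℚ (n !) * (egf one[ m ] ^ l) n
degChrom-K≡coeff m n l 1≤m = begin
  ℕtoℚ (length (filter (good? m (K n)) cs))
    ≡⟨ length-filter≡sumℚ (good? m (K n)) cs ⟩
  sumℚ (map (λ c → ⟦ good? m (K n) c ⟧) cs)
    ≡⟨ cong sumℚ (Listₚ.map-cong good≡weight cs) ⟩
  vecSum l n (colourWeight one[ m ] ∘ toList)
    ≡⟨ vecSum-colourWeight l n one[ m ] ⟩
  ℕtoℚ (n !) * (egf one[ m ] ^ l) n
    ∎
  where
  cs = allVecs (allFin l) n
  good≡weight : ∀ c → ⟦ good? m (K n) c ⟧ ≡ colourWeight one[ m ] (toList c)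
  good≡weight c = trans (⟦⟧-⇔ (good-K⇔ m c 1≤m) (good? m (K n) c) (all? (λ j → occurrences j (toList c) ≤? m)))
                        (sym (colourWeight-one[m] m (toList c)))

lemma3 : (m n : ℕ) → 1 ≤ m → 1 ≤ n → (λ' : ℕ) → 1 ≤ λ' →
    ℕtoℚ (degChrom m (K n) λ') ≡ sumFrom1 n (λ k → bell n k one[ m ] * falling λ' k)
lemma3 m n 1≤m 1≤n λ' _ = begin
  ℕtoℚ (degChrom m (K n) λ')
    ≡⟨ degChrom-K≡coeff m n λ' 1≤m ⟩
  ℕtoℚ (n !) * (egf one[ m ] ^ λ') n
    ≡⟨ cong (ℕtoℚ (n !) *_) (^-congˡ λ' (egf≋egf⁺⊕𝟙 one[ m ] refl) n) ⟩
  ℕtoℚ (n !) * ((egf⁺ one[ m ] ⊕ 𝟙) ^ λ') n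
    ≡⟨ bell-falling-sum one[ m ] n 1≤n λ' ⟨
  sumFrom1 n (λ k → bell n k one[ m ] * falling λ' k)
    ∎
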